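{- Let $\mathfrak{M}=(\mathbf{M},\models,\mathcal{P}(\mathscr{L}))$ be a normal abstract model structure with induced relation $\vdash_{\mathfrak{M}}$, and let $\Gamma\subseteq\mathscr{L}$ be maximal finitely satisfiable. If $\Gamma$ is satisfiable, then $\Gamma$ is $\vdash_{\mathfrak{M}}$-closed.
   Context: An abstract model structure is a triple $(\mathbf{M},\models,\mathcal{P}(\mathscr{L}))$ with $\mathbf{M}\neq\emptyset$, $\mathscr{L}$ a set and $\models\,\subseteq\mathbf{M}\times\mathcal{P}(\mathscr{L})$. It is normal if for all $m$ and $\Gamma$: $m\models\Gamma$ iff $m\models\{\alpha\}$ for all $\alpha\in\Gamma$. $\Gamma$ is satisfiable if $m\models\Gamma$ for some $m\in\mathbf{M}$; finitely satisfiable if every finite subset is satisfiable; maximal finitely satisfiable if finitely satisfiable and no proper superset in $\mathscr{L}$ is finitely satisfiable. $\Gamma\vdash_{\mathfrak{M}}\alpha$ iff every $m$ with $m\models\Gamma$ has $m\models\{\alpha\}$. $\Gamma$ is $\vdash_{\mathfrak{M}}$-closed if for all $\beta\in\mathscr{L}$: $\Gamma\vdash_{\mathfrak{M}}\beta$ iff $\beta\in\Gamma$. -}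

module Defs where

open import Level using (Level; _⊔_; suc)
open import Data.Product using (Σ; ∃; _×_)
open import Data.List using (List)
open import Data.List.Membership.Propositional using (_∈_)
open import Relation.Unary using (Pred; _⊆_)
open import Relation.Nullary using (¬_)
open import Relation.Binary.PropositionalEquality using (_≡_)

-- Abstract model structure (M, ⊨, P(L)); subsets of L are predicates on L.
record AMS (m l r : Level) : Set (suc (m ⊔ l ⊔ r)) where
  field
    M      : Set m
    M-ne   : M
    L      : Set l
    _⊨_    : M → Pred L l → Set r

module _ {m l r} (𝔐 : AMS m l r) where
  open AMS 𝔐

  ｛_｝ : L → Pred L l
  ｛ α ｝ = λ β → β ≡ α

  ⟦_⟧ : List L → Pred L l
  ⟦ xs ⟧ = λ β → β ∈ xs

  Normal : Set (m ⊔ l ⊔ suc l ⊔ r)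
  Normal = ∀ (x : M) (Γ : Pred L l) →
             (x ⊨ Γ → ∀ α → Γ α → x ⊨ ｛ α ｝) ×
             ((∀ α → Γ α → x ⊨ ｛ α ｝) → x ⊨ Γ)

  Satisfiable : Pred L l → Set (m ⊔ r)
  Satisfiable Γ = ∃ λ (x : M) → x ⊨ Γ

  FinSat : Pred L l → Set (m ⊔ l ⊔ r)
  FinSat Γ = ∀ (xs : List L) → ⟦ xs ⟧ ⊆ Γ → Satisfiable ⟦ xs ⟧

  ProperSuperset : Pred L l → Pred L l → Set l
  ProperSuperset Δ Γ = Γ ⊆ Δ × ¬ (Δ ⊆ Γ)

  MaxFinSat : Pred L l → Set (m ⊔ l ⊔ suc l ⊔ r)
  MaxFinSat Γ = FinSat Γ × (∀ (Δ : Pred L l) → ProperSuperset Δ Γ → ¬ FinSat Δ)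

  _⊢_ : Pred L l → L → Set (m ⊔ r)
  Γ ⊢ α = ∀ (x : M) → x ⊨ Γ → x ⊨ ｛ α ｝

  Closed : Pred L l → Set (m ⊔ l ⊔ r)
  Closed Γ = ∀ (β : L) → (Γ ⊢ β → Γ β) × (Γ β → Γ ⊢ β)

{-# OPTIONS --safe #-}
module Submission where

open import Defs
open import Axiom.ExcludedMiddle using (ExcludedMiddle)
open import Axiom.DoubleNegationElimination using (em⇒dne)
open import Data.Product using (_,_; proj₁; proj₂)
open import Data.Sum using (inj₁; inj₂; [_,_])
open import Relation.Binary.PropositionalEquality using (refl)
open import Relation.Nullary using (¬_)
open import Relation.Unary using (Pred; _⊆_; _∪_)

-- A model m of Γ satisfies Γ ∪ {β} whenever Γ ⊢ β, so Γ ∪ {β} is finitely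
-- satisfiable; maximality then rules out β ∉ Γ, and excluded middle turns
-- this into β ∈ Γ. The converse direction is normality alone.

module _ {m l r} (𝔐 : AMS m l r) where
  open AMS 𝔐

  maxFinSat-absorbs : ∀ {Γ β} → MaxFinSat 𝔐 Γ → FinSat 𝔐 (Γ ∪ ｛_｝ 𝔐 β) → ¬ ¬ Γ β
  maxFinSat-absorbs (_ , maximal) finSat β∉Γ =
    maximal _ (inj₁ , λ Γ∪β⊆Γ → β∉Γ (Γ∪β⊆Γ (inj₂ refl))) finSat

  module _ (normal : Normal 𝔐) where

    ⊨-antitone : ∀ {x Γ Δ} → x ⊨ Γ → Δ ⊆ Γ → x ⊨ Δ
    ⊨-antitone {x} {Γ} {Δ} x⊨Γ Δ⊆Γ =
      proj₂ (normal x Δ) λ α Δα → proj₁ (normal x Γ) x⊨Γ α (Δ⊆Γ Δα)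

    ⊨-∪ : ∀ {x Γ Δ} → x ⊨ Γ → x ⊨ Δ → x ⊨ (Γ ∪ Δ)
    ⊨-∪ {x} {Γ} {Δ} x⊨Γ x⊨Δ =
      proj₂ (normal x (Γ ∪ Δ)) λ α →
        [ proj₁ (normal x Γ) x⊨Γ α , proj₁ (normal x Δ) x⊨Δ α ]

    satisfiable⇒finSat : ∀ {Γ} → Satisfiable 𝔐 Γ → FinSat 𝔐 Γ
    satisfiable⇒finSat (x , x⊨Γ) _ xs⊆Γ = x , ⊨-antitone x⊨Γ xs⊆Γ

    ∈⇒⊢ : ∀ {Γ β} → Γ β → _⊢_ 𝔐 Γ β
    ∈⇒⊢ Γβ _ x⊨Γ = ⊨-antitone x⊨Γ λ { refl → Γβ }

theorem3p11 : ∀ {m l r} → ExcludedMiddle l → (𝔐 : AMS m l r) → Normal 𝔐 →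
    (Γ : Pred (AMS.L 𝔐) l) → MaxFinSat 𝔐 Γ → Satisfiable 𝔐 Γ → Closed 𝔐 Γ
theorem3p11 em 𝔐 normal Γ maxFinSat (x , x⊨Γ) β = ⊢⇒∈ , ∈⇒⊢ 𝔐 normal
  where
  ⊢⇒∈ : _⊢_ 𝔐 Γ β → Γ β
  ⊢⇒∈ Γ⊢β = em⇒dne em (maxFinSat-absorbs 𝔐 maxFinSat
    (satisfiable⇒finSat 𝔐 normal (x , ⊨-∪ 𝔐 normal x⊨Γ (Γ⊢β x x⊨Γ))))
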